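{- Let $\lambda=(\lambda_1,\ldots,\lambda_t)$ be an unrefinable partition into distinct parts with $\#\mathcal{M}_\lambda=\lfloor\lambda_t/2\rfloor$, where $\lambda_t>3$ is a prime number. Then the set $S_\lambda=\mathbb{N}_0\setminus\{\lambda_1,\ldots,\lambda_t\}$ is a numerical semigroup.
   Context: A partition into distinct parts is a sequence $\lambda=(\lambda_1,\ldots,\lambda_t)$ of positive integers with $\lambda_1<\cdots<\lambda_t$ and $t\ge 2$. Its set of missing parts is $\mathcal{M}_\lambda=\{1,\ldots,\lambda_t\}\setminus\{\lambda_1,\ldots,\lambda_t\}$. $\lambda$ is refinable if some part equals a sum of at least two pairwise distinct missing parts, and unrefinable otherwise. A numerical semigroup is a subset of $\mathbb{N}_0$ containing $0$, closed under addition, with finite complement in $\mathbb{N}_0$. -}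

module Defs where

open import Data.Nat using (ℕ; zero; suc; _+_; _≤_; _<_; _⊔_; _/_)
open import Data.Nat.Primality using (Prime)
open import Data.List using (List; []; _∷_; length; filter; upTo; map; foldr)
open import Data.Nat.ListAction using (sum)
open import Data.List.Membership.Propositional using (_∈_; _∉_)
open import Data.List.Membership.DecPropositional using () renaming (_∈?_ to ∈?-gen)
open import Data.List.Relation.Binary.Sublist.Propositional using (_⊆_)
open import Data.List.Relation.Unary.All using (All)
open import Data.List.Relation.Unary.Linked using (Linked)
open import Data.Nat.Properties using (_≟_)
open import Data.Product using (Σ; ∃; _×_)
open import Relation.Nullary using (¬_; ¬?)
open import Relation.Binary.PropositionalEquality using (_≡_)

record DistinctPartition : Set where
  constructor mkDP
  field
    parts      : List ℕ
    increasing : Linked _<_ parts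
    positive   : All (λ x → 0 < x) parts
    atLeastTwo : 2 ≤ length parts

open DistinctPartition public

-- largest part λₜ (the maximum = last element, since parts are increasing)
largest : DistinctPartition → ℕ
largest p = foldr _⊔_ 0 (parts p)

private
  _∈ℕ?_ = ∈?-gen _≟_

oneTo : ℕ → List ℕ
oneTo n = map suc (upTo n)

missing : DistinctPartition → List ℕ
missing p = filter (λ x → ¬? (x ∈ℕ? parts p)) (oneTo (largest p))

-- refinable: some part equals the sum of at least two pairwise distinct missing parts.
-- Pairwise distinct missing parts = a sub-list (subsequence) of the duplicate-free list `missing p`.
Refinable : DistinctPartition → Set
Refinable p = Σ ℕ λ x → x ∈ parts p ×
              Σ (List ℕ) λ ms → ms ⊆ missing p × 2 ≤ length ms × sum ms ≡ x

Unrefinable : DistinctPartition → Set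
Unrefinable p = ¬ Refinable p

record NumericalSemigroup (S : ℕ → Set) : Set where
  field
    has-zero      : S 0
    closed-add    : ∀ a b → S a → S b → S (a + b)
    cofinite      : ∃ λ N → ∀ n → N ≤ n → S n

Sλ : DistinctPartition → ℕ → Set
Sλ p n = n ∉ parts p

-- Write n = λₜ = 2k + 1 (n is an odd prime). The numbers 1, …, 2k split into the k pairs
-- {i, n − i}; unrefinability forbids both members of a pair being missing, so #𝓜 = k forces
-- exactly one missing part in every pair. Now let a, b be missing with a + b a part. If a ≠ b,
-- the part a + b is refined by a and b. If a = b, put j = n − 2a: since 2a is a part, j is
-- missing; since a is missing, a + j = n − a is a part; and a ≠ j because 3 ∤ n, so the part
-- a + j is refined by a and j.
module Submission where

open import Defs
open import Data.Nat using (ℕ; _<_; _/_)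
open import Data.Nat.Primality using (Prime)
open import Data.List using (length)
open import Relation.Binary.PropositionalEquality using (_≡_)

open import Data.Nat using (zero; suc; _+_; _*_; _∸_; _%_; _≤_; _⊔_; z≤n; s≤s; z<s; NonTrivial)
open import Data.Nat.Properties
open import Data.Nat.Tactic.RingSolver using (solve-∀)
open import Data.Nat.DivMod using (m≡m%n+[m/n]*n; m%n<n)
open import Data.Nat.Divisibility using (_∣_; divides; m%n≡0⇒n∣m)
open import Data.Nat.Primality using (composite)
open import Data.List using (List; []; _∷_; _++_; [_]; filter; applyUpTo; foldr)
open import Data.List.Properties
  using (filter-++; length-++; length-filter; filter-all; filter-accept; filter-reject; map-upTo; foldr-forcesᵇ)
open import Data.List.Membership.Propositional using (_∈_; _∉_)
open import Data.List.Membership.Propositional.Properties using (foldr-selective)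
open import Data.List.Membership.DecPropositional _≟_ using (_∈?_)
open import Data.List.Relation.Binary.Sublist.Propositional using (_⊆_; _∷_; _∷ʳ_; minimum)
open import Data.List.Relation.Binary.Sublist.Propositional.Properties using (filter⁺)
open import Data.List.Relation.Unary.All using (All; []; _∷_)
import Data.List.Relation.Unary.All as All
open import Data.List.Relation.Unary.Linked using (Linked; [-]; _∷_)
open import Data.Product using (_×_; _,_)
open import Data.Sum using (inj₁; inj₂)
open import Data.Empty using (⊥; ⊥-elim)
open import Function using (_∘_; id)
open import Relation.Binary.PropositionalEquality
  using (refl; sym; trans; cong; cong₂; subst; _≢_; module ≡-Reasoning)
open import Relation.Binary.Definitions using (tri<; tri≈; tri>)
open import Relation.Nullary using (¬_; Dec; yes; no; ¬?)
open import Relation.Nullary.Decidable using (decidable-stable)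
open import Relation.Unary using (Pred; Decidable)

range : ℕ → ℕ → List ℕ
range a zero    = []
range a (suc m) = a ∷ range (suc a) m

applyUpTo≗range : ∀ (f : ℕ → ℕ) a m → (∀ i → f i ≡ a + i) → applyUpTo f m ≡ range a m
applyUpTo≗range f a zero    f≗ = refl
applyUpTo≗range f a (suc m) f≗ =
  cong₂ _∷_ (trans (f≗ 0) (+-identityʳ a))
            (applyUpTo≗range (f ∘ suc) (suc a) m (λ i → trans (f≗ (suc i)) (+-suc a i)))

oneTo≡range : ∀ n → oneTo n ≡ range 1 n
oneTo≡range n = trans (map-upTo suc n) (applyUpTo≗range suc 1 n (λ _ → refl))

range-∷ʳ : ∀ a m → range a (suc m) ≡ range a m ++ [ a + m ]
range-∷ʳ a zero    = cong [_] (sym (+-identityʳ a))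
range-∷ʳ a (suc m) =
  cong (a ∷_) (trans (range-∷ʳ (suc a) m) (cong (λ z → range (suc a) m ++ [ z ]) (sym (+-suc a m))))

All-<-+-suc : ∀ a m {ys} → All (_< a + suc m) ys → All (_< suc a + m) ys
All-<-+-suc a m = All.map (λ y< → ≤-trans y< (≤-reflexive (+-suc a m)))

sorted⊆range : ∀ m {a x xs} → Linked _<_ (x ∷ xs) → a ≤ x → All (_< a + m) (x ∷ xs) →
               x ∷ xs ⊆ range a m
sorted⊆range zero    {a} _ a≤x (x<a+0 ∷ _) = ⊥-elim (<⇒≱ (subst (_ <_) (+-identityʳ a) x<a+0) a≤x)
sorted⊆range (suc m) {a} sorted a≤x bounds with m≤n⇒m<n∨m≡n a≤x
... | inj₁ a<x  = a ∷ʳ sorted⊆range m sorted a<x (All-<-+-suc a m bounds)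
... | inj₂ refl = refl ∷ tail⊆ sorted (All-<-+-suc a m (All.tail bounds))
  where
  tail⊆ : ∀ {ys} → Linked _<_ (a ∷ ys) → All (_< suc a + m) ys → ys ⊆ range (suc a) m
  tail⊆ [-]              []     = minimum _
  tail⊆ (a<y ∷ sorted′) bounds′ = sorted⊆range m sorted′ a<y bounds′

-- a + a + m + m ≡ 1 + s says that the window [a, a + 2m) is symmetric: its outer elements sum to s.
outer-pair-sum : ∀ a m s → a + a + suc m + suc m ≡ suc s → a + suc (a + (m + m)) ≡ s
outer-pair-sum a m s eq = suc-injective (trans (shape a m) eq)
  where
  shape : ∀ a m → suc (a + suc (a + (m + m))) ≡ a + a + suc m + suc m
  shape = solve-∀

window-partner : ∀ a m s {x} → a + a + suc m + suc m ≡ suc s → a + x ≡ s → x ≡ suc (a + (m + m))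
window-partner a m s eq a+x≡s = +-cancelˡ-≡ a _ _ (trans a+x≡s (sym (outer-pair-sum a m s eq)))

inner-window-sum : ∀ a m s → a + a + suc m + suc m ≡ suc s → suc a + suc a + m + m ≡ suc s
inner-window-sum a m s eq = trans (shape a m) eq
  where
  shape : ∀ a m → suc a + suc a + m + m ≡ a + a + suc m + suc m
  shape = solve-∀

module PairCount {ℓ} {P : Pred ℕ ℓ} (P? : Decidable P) where

  count : List ℕ → ℕ
  count xs = length (filter P? xs)

  count-++ : ∀ xs ys → count (xs ++ ys) ≡ count xs + count ys
  count-++ xs ys = trans (cong length (filter-++ P? xs ys)) (length-++ (filter P? xs))

  count-∷-accept : ∀ {x} xs → P x → count (x ∷ xs) ≡ suc (count xs)
  count-∷-accept xs Px = cong length (filter-accept P? Px)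

  count-∷-reject : ∀ {x} xs → ¬ P x → count (x ∷ xs) ≡ count xs
  count-∷-reject xs ¬Px = cong length (filter-reject P? ¬Px)

  count-pair-≤ : ∀ {i j} → (P i → P j → ⊥) → count (i ∷ j ∷ []) ≤ 1
  count-pair-≤ {i} {j} notBoth = by-cases (P? i)
    where
    by-cases : Dec (P i) → count (i ∷ j ∷ []) ≤ 1
    by-cases (yes Pi) =
      ≤-reflexive (trans (count-∷-accept [ j ] Pi) (cong suc (count-∷-reject [] (notBoth Pi))))
    by-cases (no ¬Pi) = ≤-trans (≤-reflexive (count-∷-reject [ j ] ¬Pi)) (length-filter P? [ j ])

  count-pair-≡0 : ∀ {i j} → ¬ P i → ¬ P j → count (i ∷ j ∷ []) ≡ 0
  count-pair-≡0 ¬Pi ¬Pj = trans (count-∷-reject _ ¬Pi) (count-∷-reject [] ¬Pj)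

  count-window : ∀ a m → count (range a (suc m + suc m)) ≡
                 count (a ∷ suc (a + (m + m)) ∷ []) + count (range (suc a) (m + m))
  count-window a m = begin
    count (range a (suc m + suc m))
      ≡⟨ cong (count ∘ range a ∘ suc) (+-suc m m) ⟩
    count (a ∷ range (suc a) (suc (m + m)))
      ≡⟨ cong (count ∘ (a ∷_)) (range-∷ʳ (suc a) (m + m)) ⟩
    count ([ a ] ++ inner ++ [ b ])
      ≡⟨ count-++ [ a ] (inner ++ [ b ]) ⟩
    count [ a ] + count (inner ++ [ b ])
      ≡⟨ cong (count [ a ] +_) (count-++ inner [ b ]) ⟩
    count [ a ] + (count inner + count [ b ])
      ≡⟨ rearrange (count [ a ]) (count inner) (count [ b ]) ⟩
    (count [ a ] + count [ b ]) + count inner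
      ≡⟨ cong (_+ count inner) (count-++ [ a ] [ b ]) ⟨
    count (a ∷ b ∷ []) + count inner ∎
    where
    open ≡-Reasoning
    inner : List ℕ
    inner = range (suc a) (m + m)
    b : ℕ
    b = suc (a + (m + m))
    rearrange : ∀ x y z → x + (y + z) ≡ (x + z) + y
    rearrange = solve-∀

  module _ {s} (atMostOne : ∀ {i j} → i + j ≡ s → P i → P j → ⊥) where

    count-window-≤ : ∀ m a → a + a + m + m ≡ suc s → count (range a (m + m)) ≤ m
    count-window-≤ zero    a _  = z≤n
    count-window-≤ (suc m) a eq = begin
      count (range a (suc m + suc m))
        ≡⟨ count-window a m ⟩
      count (a ∷ suc (a + (m + m)) ∷ []) + count (range (suc a) (m + m))
        ≤⟨ +-mono-≤ (count-pair-≤ (atMostOne (outer-pair-sum a m s eq)))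
                    (count-window-≤ m (suc a) (inner-window-sum a m s eq)) ⟩
      suc m ∎
      where open ≤-Reasoning

    count-window-outer-< : ∀ m a → a + a + suc m + suc m ≡ suc s →
                           ¬ P a → ¬ P (suc (a + (m + m))) → count (range a (suc m + suc m)) < suc m
    count-window-outer-< m a eq ¬Pa ¬Pb = s≤s (begin
      count (range a (suc m + suc m))
        ≡⟨ count-window a m ⟩
      count (a ∷ suc (a + (m + m)) ∷ []) + count (range (suc a) (m + m))
        ≡⟨ cong (_+ count (range (suc a) (m + m))) (count-pair-≡0 ¬Pa ¬Pb) ⟩
      count (range (suc a) (m + m))
        ≤⟨ count-window-≤ m (suc a) (inner-window-sum a m s eq) ⟩
      m ∎)
      where open ≤-Reasoning

    count-window-< : ∀ m a → a + a + m + m ≡ suc s → ∀ {i j} → a ≤ i → a ≤ j → i + j ≡ s →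
                     ¬ P i → ¬ P j → count (range a (m + m)) < m
    count-window-< zero a eq {i} {j} a≤i a≤j i+j≡s _ _ =
      ⊥-elim (<⇒≱ (≤-reflexive (sym a+a≡1+s)) (subst (a + a ≤_) i+j≡s (+-mono-≤ a≤i a≤j)))
      where
      a+a≡1+s : a + a ≡ suc s
      a+a≡1+s = trans (sym (trans (+-identityʳ (a + a + 0)) (+-identityʳ (a + a)))) eq
    count-window-< (suc m) a eq {i} {j} a≤i a≤j i+j≡s ¬Pi ¬Pj
      with m≤n⇒m<n∨m≡n a≤i | m≤n⇒m<n∨m≡n a≤j
    ... | inj₂ refl | _         =
      count-window-outer-< m a eq ¬Pi (subst (¬_ ∘ P) (window-partner a m s eq i+j≡s) ¬Pj)
    ... | inj₁ _    | inj₂ refl =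
      count-window-outer-< m a eq ¬Pj
        (subst (¬_ ∘ P) (window-partner a m s eq (trans (+-comm j i) i+j≡s)) ¬Pi)
    ... | inj₁ a<i  | inj₁ a<j  = begin-strict
      count (range a (suc m + suc m))
        ≡⟨ count-window a m ⟩
      count (a ∷ suc (a + (m + m)) ∷ []) + count (range (suc a) (m + m))
        <⟨ +-mono-≤-< (count-pair-≤ (atMostOne (outer-pair-sum a m s eq)))
                      (count-window-< m (suc a) (inner-window-sum a m s eq) a<i a<j i+j≡s ¬Pi ¬Pj) ⟩
      suc m ∎
      where open ≤-Reasoning

prime⇒∤ : ∀ {p} d .{{_ : NonTrivial d}} → Prime p → d < p → ¬ d ∣ p
prime⇒∤ d pr d<p d∣p = Prime.notComposite pr (composite d<p d∣p)

m+m≡m*2 : ∀ m → m + m ≡ m * 2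
m+m≡m*2 = solve-∀

2∣m+m : ∀ m → 2 ∣ m + m
2∣m+m m = divides m (m+m≡m*2 m)

prime⇒odd : ∀ {p} → Prime p → 2 < p → p ≡ suc (p / 2 + p / 2)
prime⇒odd {p} pr 2<p with p % 2 in p%2 | m%n<n p 2
... | 0           | _               = ⊥-elim (prime⇒∤ 2 pr 2<p (m%n≡0⇒n∣m p 2 p%2))
... | 1           | _               =
  trans (m≡m%n+[m/n]*n p 2) (cong₂ _+_ p%2 (sym (m+m≡m*2 (p / 2))))
... | suc (suc _) | s≤s (s≤s ())

∈⇒≤foldr-⊔ : ∀ xs {x} → x ∈ xs → x ≤ foldr _⊔_ 0 xs
∈⇒≤foldr-⊔ xs = All.lookup (foldr-forcesᵇ ⊔-bounded 0 xs ≤-refl)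
  where
  ⊔-bounded : ∀ {o} x y → x ⊔ y ≤ o → x ≤ o × y ≤ o
  ⊔-bounded x y x⊔y≤o = m⊔n≤o⇒m≤o x y x⊔y≤o , m⊔n≤o⇒n≤o x y x⊔y≤o

foldr-⊔∈ : ∀ xs → 0 < foldr _⊔_ 0 xs → foldr _⊔_ 0 xs ∈ xs
foldr-⊔∈ xs 0<max with foldr-selective ⊔-sel 0 xs
... | inj₁ max≡0 = ⊥-elim (<-irrefl (sym max≡0) 0<max)
... | inj₂ max∈  = max∈

module Unrefinability (p : DistinctPartition) (unrefinable : Unrefinable p) where

  missing? : Decidable (_∉ parts p)
  missing? x = ¬? (x ∈? parts p)

  pair⊆missing : ∀ {i j} → 0 < i → i < j → j ≤ largest p → i ∉ parts p → j ∉ parts p →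
                 i ∷ j ∷ [] ⊆ missing p
  pair⊆missing {i} {j} 0<i i<j j≤n i∉ j∉ =
    subst (_⊆ missing p) (filter-all missing? (i∉ ∷ j∉ ∷ []))
      (filter⁺ missing? missing? (λ { refl → id })
        (subst (i ∷ j ∷ [] ⊆_) (sym (oneTo≡range (largest p)))
          (sorted⊆range (largest p) (i<j ∷ [-]) 0<i
            (s≤s (≤-trans (<⇒≤ i<j) j≤n) ∷ s≤s j≤n ∷ []))))

  ordered-missing-sum∉parts : ∀ {i j} → 0 < i → i < j →
                              i ∉ parts p → j ∉ parts p → i + j ∉ parts p
  ordered-missing-sum∉parts {i} {j} 0<i i<j i∉ j∉ i+j∈ =
    unrefinable (i + j , i+j∈ , i ∷ j ∷ [] , pair⊆missing 0<i i<j j≤n i∉ j∉ ,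
                 s≤s (s≤s z≤n) , cong (i +_) (+-identityʳ j))
    where
    j≤n : j ≤ largest p
    j≤n = ≤-trans (m≤n+m j i) (∈⇒≤foldr-⊔ (parts p) i+j∈)

  distinct-missing-sum∉parts : ∀ {i j} → 0 < i → 0 < j → i ≢ j →
                               i ∉ parts p → j ∉ parts p → i + j ∉ parts p
  distinct-missing-sum∉parts {i} {j} 0<i 0<j i≢j i∉ j∉ with <-cmp i j
  ... | tri< i<j _ _ = ordered-missing-sum∉parts 0<i i<j i∉ j∉
  ... | tri≈ _ i≡j _ = ⊥-elim (i≢j i≡j)
  ... | tri> _ _ j<i = subst (_∉ parts p) (+-comm j i) (ordered-missing-sum∉parts 0<j j<i j∉ i∉)

module PrimeLargestPart
  (p : DistinctPartition) (unrefinable : Unrefinable p)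
  (#missing : length (missing p) ≡ largest p / 2) (n-prime : Prime (largest p)) (3<n : 3 < largest p)
  where

  open Unrefinability p unrefinable
  open PairCount missing?

  n : ℕ
  n = largest p

  k : ℕ
  k = n / 2

  2<n : 2 < n
  2<n = <-trans (s≤s (s≤s (s≤s z≤n))) 3<n

  n≡1+2k : n ≡ suc (k + k)
  n≡1+2k = prime⇒odd n-prime 2<n

  n∈parts : n ∈ parts p
  n∈parts = foldr-⊔∈ (parts p) (<-trans z<s 3<n)

  missing-pair-absurd : ∀ {i j} → i + j ≡ n → i ∉ parts p → j ∉ parts p → ⊥
  missing-pair-absurd {zero}  {j} i+j≡n _  j∉ = j∉ (subst (_∈ parts p) (sym i+j≡n) n∈parts)
  missing-pair-absurd {suc i} {zero} i+j≡n i∉ _ =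
    i∉ (subst (_∈ parts p) (sym (trans (sym (+-identityʳ (suc i))) i+j≡n)) n∈parts)
  missing-pair-absurd {suc i} {suc j} i+j≡n i∉ j∉ =
    distinct-missing-sum∉parts z<s z<s i≢j i∉ j∉ (subst (_∈ parts p) (sym i+j≡n) n∈parts)
    where
    i≢j : suc i ≢ suc j
    i≢j refl = prime⇒∤ 2 n-prime 2<n (subst (2 ∣_) i+j≡n (2∣m+m (suc i)))

  count-window≡k : count (range 1 (k + k)) ≡ k
  count-window≡k = begin
    count window                           ≡⟨ +-identityʳ _ ⟨
    count window + 0                       ≡⟨ cong (count window +_) (count-∷-reject [] (λ n∉ → n∉ n∈parts)) ⟨
    count window + count [ n ]             ≡⟨ cong (λ z → count window + count [ z ]) n≡1+2k ⟩
    count window + count [ suc (k + k) ]   ≡⟨ count-++ window [ suc (k + k) ] ⟨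
    count (window ++ [ suc (k + k) ])      ≡⟨ cong count (range-∷ʳ 1 (k + k)) ⟨
    count (range 1 (suc (k + k)))          ≡⟨ cong (count ∘ range 1) n≡1+2k ⟨
    count (range 1 n)                      ≡⟨ cong count (oneTo≡range n) ⟨
    length (missing p)                     ≡⟨ #missing ⟩
    k ∎
    where
    open ≡-Reasoning
    window : List ℕ
    window = range 1 (k + k)

  part-pair-absurd : ∀ {i j} → 0 < i → 0 < j → i + j ≡ n → i ∈ parts p → j ∈ parts p → ⊥
  part-pair-absurd 0<i 0<j i+j≡n i∈ j∈ =
    <-irrefl count-window≡k
      (count-window-< missing-pair-absurd k 1 (cong suc (sym n≡1+2k)) 0<i 0<j i+j≡n
        (λ i∉ → i∉ i∈) (λ j∉ → j∉ j∈))

  double-missing∉parts : ∀ {a} → 0 < a → a ∉ parts p → a + a ∉ parts p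
  double-missing∉parts {a} 0<a a∉ 2a∈ =
    distinct-missing-sum∉parts 0<a 0<j a≢j a∉ j∉ a+j∈
    where
    2a<n : a + a < n
    2a<n = ≤∧≢⇒< (∈⇒≤foldr-⊔ (parts p) 2a∈)
                 (λ 2a≡n → prime⇒∤ 2 n-prime 2<n (subst (2 ∣_) 2a≡n (2∣m+m a)))
    j : ℕ
    j = n ∸ (a + a)
    0<j : 0 < j
    0<j = m<n⇒0<n∸m 2a<n
    2a+j≡n : a + a + j ≡ n
    2a+j≡n = m+[n∸m]≡n (<⇒≤ 2a<n)
    j∉ : j ∉ parts p
    j∉ = part-pair-absurd (≤-trans 0<a (m≤m+n a a)) 0<j 2a+j≡n 2a∈
    a+j∈ : a + j ∈ parts p
    a+j∈ = decidable-stable (a + j ∈? parts p)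
             (missing-pair-absurd (trans (sym (+-assoc a a j)) 2a+j≡n) a∉)
    a≢j : a ≢ j
    a≢j a≡j = prime⇒∤ 3 n-prime 3<n
                (divides a (trans (sym 2a+j≡n) (trans (cong (a + a +_) (sym a≡j)) (m+m+m≡m*3 a))))
      where
      m+m+m≡m*3 : ∀ m → m + m + m ≡ m * 3
      m+m+m≡m*3 = solve-∀

  missing-closed-under-+ : ∀ a b → a ∉ parts p → b ∉ parts p → a + b ∉ parts p
  missing-closed-under-+ zero    b       _  b∉ = b∉
  missing-closed-under-+ (suc a) zero    a∉ _  = subst (_∉ parts p) (sym (+-identityʳ (suc a))) a∉
  missing-closed-under-+ (suc a) (suc b) a∉ b∉ with suc a ≟ suc b
  ... | yes refl = double-missing∉parts z<s a∉
  ... | no  a≢b  = distinct-missing-sum∉parts z<s z<s a≢b a∉ b∉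

mainTheorem4 : (p : DistinctPartition) → Unrefinable p →
    length (missing p) ≡ largest p / 2 → Prime (largest p) → 3 < largest p →
    NumericalSemigroup (Sλ p)
mainTheorem4 p unrefinable #missing n-prime 3<n = record
  { has-zero   = λ 0∈ → <-irrefl refl (All.lookup (positive p) 0∈)
  ; closed-add = missing-closed-under-+
  ; cofinite   = suc (largest p) , λ m n<m m∈ → <⇒≱ n<m (∈⇒≤foldr-⊔ (parts p) m∈)
  }
  where open PrimeLargestPart p unrefinable #missing n-prime 3<n
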